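{- Let $n\ge1$ and let $A$ be a positive integer with exactly $n$ decimal digits. If $A\times A^{*}$ is a palindrome with exactly $2n-1$ decimal digits, then $(A,A^{*})$ is a polynomial pair.
   Context: For a positive integer $A$ with decimal representation $A=\sum_{i=0}^{a} a_i 10^i$ (digits $a_i\in\{0,\dots,9\}$, $a_a\neq0$), let $P(A,x)=\sum_{i=0}^a a_ix^i$ and let $A^{*}=\sum_{i=0}^a a_i10^{a-i}$ be its reversal. An integer $C$ is a palindrome if $C=C^{*}$. A pair $(A,B)$ of positive integers is a polynomial pair if $P(A,x)P(B,x)=P(A\times B,x)$. -}

module Defs where

open import Data.Nat using (ℕ; zero; suc; _+_; _*_; _≡ᵇ_)
open import Data.Nat.DivMod using (_/_; _%_)
open import Data.List using (List; []; _∷_; length; reverse; map)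
open import Relation.Binary.PropositionalEquality using (_≡_; refl)
open import Data.Bool using (true; false)

-- Decimal digits of a natural number, least significant digit first,
-- with no leading zeros (digits 0 = []).  Fuel-based: m is at least the
-- number of digits since a positive A has fewer than A+1 digits.
digitsAux : ℕ → ℕ → List ℕ
digitsAux zero    _ = []
digitsAux (suc k) m with m ≡ᵇ 0
... | true  = []
... | false = (m % 10) ∷ digitsAux k (m / 10)

digits : ℕ → List ℕ
digits m = digitsAux m m

numDigits : ℕ → ℕ
numDigits m = length (digits m)

fromDigits : List ℕ → ℕ
fromDigits []       = 0
fromDigits (d ∷ ds) = d + 10 * fromDigits ds

rev : ℕ → ℕ
rev m = fromDigits (reverse (digits m))

Palindrome : ℕ → Set
Palindrome c = c ≡ rev c

-- Polynomials with coefficients in ℕ as coefficient lists (constant term first).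
-- Polynomial addition and multiplication:
_⊕_ : List ℕ → List ℕ → List ℕ
[]       ⊕ q        = q
p        ⊕ []       = p
(a ∷ p)  ⊕ (b ∷ q)  = (a + b) ∷ (p ⊕ q)

_⊗_ : List ℕ → List ℕ → List ℕ
[]      ⊗ q = []
(a ∷ p) ⊗ q = map (a *_) q ⊕ (0 ∷ (p ⊗ q))

-- P(A,x) is the coefficient list `digits A`.  (A,B) is a polynomial pair iff
-- P(A,x) P(B,x) = P(A×B,x) as polynomials, i.e. equal coefficient lists.
-- (Both sides have nonzero leading coefficient when A,B>0, so list equality
-- is exactly polynomial equality.)
PolynomialPair : ℕ → ℕ → Set
PolynomialPair a b = digits a ⊗ digits b ≡ digits (a * b)

module Submission where

-- Digit lists are least significant digit first; write
-- ⟦l⟧ = fromDigits l for the value of l in base 10 and ⟦l⟧ʳ for the value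
-- of its reversal, so that rev m = ⟦digits m⟧ʳ.  Let a = digits A, b its
-- reversal and N = A * rev A.  The coefficient list c = a ⊗ b satisfies
--   ⟦c⟧ = A · rev A = N,   ⟦c⟧ʳ = rev A · A = N = rev N,   |c| = 2n - 1,
-- because ⟦_⟧ and ⟦_⟧ʳ are both multiplicative on coefficient lists.  A
-- comparison lemma then forces c = digits N: a list of natural coefficients
-- with the same length and value as a digit list, and no larger reversed
-- value, must coincide with it (carries only increase the leading part).
-- Finally b = digits (rev A), since the palindrome hypothesis forbids A to
-- end in 0.  The file develops, in order: evaluation of digit lists,
-- canonical decimal expansions, multiplicativity of ⟦_⟧ and ⟦_⟧ʳ, the
-- comparison lemma, the last digit of a reversal, and the theorem.

open import Defs
open import Data.Nat using (ℕ; _*_; _∸_; _≥_; _>_)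
open import Relation.Binary.PropositionalEquality using (_≡_)

open import Data.Nat using (zero; suc; _+_; _^_; _≤_; _<_; z≤n; s≤s)
open import Data.Nat.Properties
open import Data.Nat.DivMod
  using (_/_; _%_; m≡m%n+[m/n]*n; [m+kn]%n≡m%n; m%n<n; m%n≤m; m<n⇒m%n≡m; %-distribˡ-*; m/n<m;
         m<n⇒m/n≡0; m*n/n≡m; +-distrib-/-∣ʳ)
open import Data.Nat.Divisibility using (n∣m*n)
open import Data.Nat.Tactic.RingSolver using (solve-∀)
open import Data.List using (List; []; _∷_; length; reverse; map; _∷ʳ_)
open import Data.List.Properties using (unfold-reverse; reverse-map; length-reverse; reverse-involutive; length-map)
open import Data.List.Relation.Unary.All as All using (All; []; _∷_)
open import Data.List.Relation.Unary.Any.Properties as Any using ()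
open import Relation.Nullary using (contradiction)
open import Relation.Binary.PropositionalEquality
  using (_≢_; refl; sym; trans; cong; cong₂; subst; subst₂; module ≡-Reasoning)

fromDigitsʳ : List ℕ → ℕ
fromDigitsʳ l = fromDigits (reverse l)

fromDigits-∷ʳ : ∀ l x → fromDigits (l ∷ʳ x) ≡ fromDigits l + x * 10 ^ length l
fromDigits-∷ʳ []      x = trans (+-identityʳ x) (sym (*-identityʳ x))
fromDigits-∷ʳ (y ∷ l) x rewrite fromDigits-∷ʳ l x = shift y (fromDigits l) x (10 ^ length l)
  where
  shift : ∀ y v x p → y + 10 * (v + x * p) ≡ y + 10 * v + x * (10 * p)
  shift = solve-∀

fromDigitsʳ-∷ : ∀ x l → fromDigitsʳ (x ∷ l) ≡ fromDigitsʳ l + x * 10 ^ length l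
fromDigitsʳ-∷ x l rewrite unfold-reverse x l | fromDigits-∷ʳ (reverse l) x | length-reverse l = refl

fromDigitsʳ-< : ∀ l → All (_< 10) l → fromDigitsʳ l < 10 ^ length l
fromDigitsʳ-< []      []          = s≤s z≤n
fromDigitsʳ-< (x ∷ l) (x<10 ∷ l<10) rewrite fromDigitsʳ-∷ x l = begin-strict
    fromDigitsʳ l + x * P  <⟨ +-monoˡ-< (x * P) (fromDigitsʳ-< l l<10) ⟩
    P + x * P              ≤⟨ +-monoʳ-≤ P (*-monoˡ-≤ P (≤-pred x<10)) ⟩
    P + 9 * P              ≡⟨ ten-times P ⟩
    10 * P                 ∎
  where
  open ≤-Reasoning
  P = 10 ^ length l
  ten-times : ∀ P → P + 9 * P ≡ 10 * P
  ten-times = solve-∀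

-- Canonical decimal expansions: digits below 10 and no leading zero, the
-- latter expressed as "every nonempty suffix has positive value".
data Canonical : List ℕ → Set where
  nil  : Canonical []
  cons : ∀ {d l} → d < 10 → Canonical l → 0 < d + 10 * fromDigits l → Canonical (d ∷ l)

canonical⇒digits : ∀ {l} → Canonical l → All (_< 10) l
canonical⇒digits nil          = []
canonical⇒digits (cons d<10 c _) = d<10 ∷ canonical⇒digits c

/10-fuel : ∀ {m k} → suc m ≤ suc k → suc m / 10 ≤ k
/10-fuel {m} (s≤s m≤k) = ≤-pred (≤-trans (m/n<m (suc m) 10 (s≤s (s≤s z≤n))) (s≤s m≤k))

fromDigits-digitsAux : ∀ k m → m ≤ k → fromDigits (digitsAux k m) ≡ m
fromDigits-digitsAux zero    zero    _    = refl
fromDigits-digitsAux (suc k) zero    _    = refl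
fromDigits-digitsAux (suc k) (suc m) m≤k
  rewrite fromDigits-digitsAux k (suc m / 10) (/10-fuel m≤k)
        | *-comm 10 (suc m / 10) = sym (m≡m%n+[m/n]*n (suc m) 10)

canonical-digitsAux : ∀ k m → m ≤ k → Canonical (digitsAux k m)
canonical-digitsAux zero    zero    _    = nil
canonical-digitsAux (suc k) zero    _    = nil
canonical-digitsAux (suc k) (suc m) m≤k =
  cons (m%n<n (suc m) 10) (canonical-digitsAux k (suc m / 10) (/10-fuel m≤k)) positive
  where
  positive : 0 < suc m % 10 + 10 * fromDigits (digitsAux k (suc m / 10))
  positive rewrite fromDigits-digitsAux k (suc m / 10) (/10-fuel m≤k)
                 | *-comm 10 (suc m / 10) | sym (m≡m%n+[m/n]*n (suc m) 10) = s≤s z≤n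

fromDigits-digits : ∀ m → fromDigits (digits m) ≡ m
fromDigits-digits m = fromDigits-digitsAux m m ≤-refl

canonical-digits : ∀ m → Canonical (digits m)
canonical-digits m = canonical-digitsAux m m ≤-refl

%10-shift : ∀ x u → (x + 10 * u) % 10 ≡ x % 10
%10-shift x u = trans (cong (λ z → (x + z) % 10) (*-comm 10 u)) ([m+kn]%n≡m%n x u 10)

%10-∷ : ∀ {d} v → d < 10 → (d + 10 * v) % 10 ≡ d
%10-∷ {d} v d<10 = trans (%10-shift d v) (m<n⇒m%n≡m d<10)

/10-∷ : ∀ {d} v → d < 10 → (d + 10 * v) / 10 ≡ v
/10-∷ {d} v d<10 = begin
    (d + 10 * v) / 10      ≡⟨ cong (λ z → (d + z) / 10) (*-comm 10 v) ⟩
    (d + v * 10) / 10      ≡⟨ +-distrib-/-∣ʳ d (n∣m*n v) ⟩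
    d / 10 + v * 10 / 10   ≡⟨ cong₂ _+_ (m<n⇒m/n≡0 d<10) (m*n/n≡m v 10) ⟩
    v                      ∎
  where open ≡-Reasoning

digitsAux-step : ∀ k {v} → 0 < v → digitsAux (suc k) v ≡ (v % 10) ∷ digitsAux k (v / 10)
digitsAux-step k {suc v} _ = refl

digitsAux-fromDigits : ∀ {l} k → Canonical l → length l ≤ k → digitsAux k (fromDigits l) ≡ l
digitsAux-fromDigits zero    nil _ = refl
digitsAux-fromDigits (suc k) nil _ = refl
digitsAux-fromDigits (suc k) (cons {d} {l} d<10 c positive) (s≤s |l|≤k) = begin
    digitsAux (suc k) (d + 10 * v)                          ≡⟨ digitsAux-step k positive ⟩
    (d + 10 * v) % 10 ∷ digitsAux k ((d + 10 * v) / 10)     ≡⟨ cong₂ (λ x y → x ∷ digitsAux k y) (%10-∷ v d<10) (/10-∷ v d<10) ⟩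
    d ∷ digitsAux k v                                       ≡⟨ cong (d ∷_) (digitsAux-fromDigits k c |l|≤k) ⟩
    d ∷ l                                                   ∎
  where
  open ≡-Reasoning
  v = fromDigits l

-- The value of a canonical list bounds its length, so it is enough fuel.
length≤fromDigits : ∀ {l} → Canonical l → length l ≤ fromDigits l
length≤fromDigits nil = z≤n
length≤fromDigits (cons {d} {l} _ c positive) =
  ≤-trans (s≤s (length≤fromDigits c)) (step d (fromDigits l) positive)
  where
  step : ∀ d v → 0 < d + 10 * v → suc v ≤ d + 10 * v
  step d zero    positive = positive
  step d (suc v) _        = ≤-trans (subst (suc v <_) (*-comm (suc v) 10) (m<m*n (suc v) 10 (s≤s (s≤s z≤n))))
                                    (m≤n+m (10 * suc v) d)

digits-fromDigits : ∀ {l} → Canonical l → digits (fromDigits l) ≡ l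
digits-fromDigits {l} c = digitsAux-fromDigits (fromDigits l) c (length≤fromDigits c)

positive-∷ʳ : ∀ l {x} → 0 < x → 0 < fromDigits (l ∷ʳ x)
positive-∷ʳ []      x>0 = ≤-trans x>0 (m≤m+n _ _)
positive-∷ʳ (y ∷ l) x>0 = ≤-trans (positive-∷ʳ l x>0) (≤-trans (m≤n*m _ 10) (m≤n+m _ y))

canonical-∷ʳ : ∀ l {x} → All (_< 10) l → x < 10 → 0 < x → Canonical (l ∷ʳ x)
canonical-∷ʳ []      []            x<10 x>0 = cons x<10 nil (positive-∷ʳ [] x>0)
canonical-∷ʳ (y ∷ l) (y<10 ∷ l<10) x<10 x>0 = cons y<10 (canonical-∷ʳ l l<10 x<10 x>0) (positive-∷ʳ (y ∷ l) x>0)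

All-reverse : ∀ {P : ℕ → Set} {l} → All P l → All P (reverse l)
All-reverse ps = All.tabulate (λ x∈ → All.lookup ps (Any.reverse⁻ x∈))

canonical-reverse : ∀ {x l} → Canonical (x ∷ l) → x ≢ 0 → Canonical (reverse (x ∷ l))
canonical-reverse {x} {l} (cons x<10 c _) x≢0 =
  subst Canonical (sym (unfold-reverse x l))
        (canonical-∷ʳ (reverse l) (All-reverse (canonical⇒digits c)) x<10 (n≢0⇒n>0 x≢0))

digits-rev : ∀ m → m % 10 ≢ 0 → digits (rev m) ≡ reverse (digits m)
digits-rev zero    ends≢0 = contradiction refl ends≢0
digits-rev (suc m) ends≢0 = digits-fromDigits (canonical-reverse (canonical-digits (suc m)) ends≢0)

fromDigits-⊕ : ∀ u v → fromDigits (u ⊕ v) ≡ fromDigits u + fromDigits v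
fromDigits-⊕ []      v       = refl
fromDigits-⊕ (x ∷ u) []      = sym (+-identityʳ _)
fromDigits-⊕ (x ∷ u) (y ∷ v) rewrite fromDigits-⊕ u v = regroup x y (fromDigits u) (fromDigits v)
  where
  regroup : ∀ x y a b → x + y + 10 * (a + b) ≡ x + 10 * a + (y + 10 * b)
  regroup = solve-∀

fromDigits-scale : ∀ a u → fromDigits (map (a *_) u) ≡ a * fromDigits u
fromDigits-scale a []      = sym (*-zeroʳ a)
fromDigits-scale a (x ∷ u) rewrite fromDigits-scale a u = distribute a x (fromDigits u)
  where
  distribute : ∀ a x v → a * x + 10 * (a * v) ≡ a * (x + 10 * v)
  distribute = solve-∀

fromDigits-⊗ : ∀ p q → fromDigits (p ⊗ q) ≡ fromDigits p * fromDigits q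
fromDigits-⊗ []      q = refl
fromDigits-⊗ (a ∷ p) q
  rewrite fromDigits-⊕ (map (a *_) q) (0 ∷ (p ⊗ q)) | fromDigits-scale a q | fromDigits-⊗ p q
  = distribute a (fromDigits p) (fromDigits q)
  where
  distribute : ∀ a p q → a * q + (0 + 10 * (p * q)) ≡ (a + 10 * p) * q
  distribute = solve-∀

fromDigitsʳ-scale : ∀ a u → fromDigitsʳ (map (a *_) u) ≡ a * fromDigitsʳ u
fromDigitsʳ-scale a u rewrite sym (reverse-map (a *_) u) = fromDigits-scale a (reverse u)

⊕-identityʳ : ∀ u → u ⊕ [] ≡ u
⊕-identityʳ []      = refl
⊕-identityʳ (x ∷ u) = refl

length-⊕ : ∀ u v → length u ≤ length v → length (u ⊕ v) ≡ length v
length-⊕ []      v       _         = refl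
length-⊕ (a ∷ u) (b ∷ v) (s≤s u≤v) = cong suc (length-⊕ u v u≤v)

fromDigitsʳ-⊕ : ∀ u v → length u ≤ length v →
                fromDigitsʳ (u ⊕ v) ≡ fromDigitsʳ u * 10 ^ (length v ∸ length u) + fromDigitsʳ v
fromDigitsʳ-⊕ []      v       _         = refl
fromDigitsʳ-⊕ (a ∷ u) (b ∷ v) (s≤s u≤v) = begin
    fromDigitsʳ ((a + b) ∷ (u ⊕ v))
  ≡⟨ fromDigitsʳ-∷ (a + b) (u ⊕ v) ⟩
    fromDigitsʳ (u ⊕ v) + (a + b) * 10 ^ length (u ⊕ v)
  ≡⟨ cong₂ (λ r k → r + (a + b) * 10 ^ k) (fromDigitsʳ-⊕ u v u≤v) (length-⊕ u v u≤v) ⟩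
    ru * S + rv + (a + b) * 10 ^ length v
  ≡⟨ cong (λ z → ru * S + rv + (a + b) * z) (sym split) ⟩
    ru * S + rv + (a + b) * (10 ^ length u * S)
  ≡⟨ regroup ru rv a b (10 ^ length u) S ⟩
    (ru + a * 10 ^ length u) * S + (rv + b * (10 ^ length u * S))
  ≡⟨ cong (λ z → (ru + a * 10 ^ length u) * S + (rv + b * z)) split ⟩
    (ru + a * 10 ^ length u) * S + (rv + b * 10 ^ length v)
  ≡⟨ sym (cong₂ (λ x y → x * S + y) (fromDigitsʳ-∷ a u) (fromDigitsʳ-∷ b v)) ⟩
    fromDigitsʳ (a ∷ u) * S + fromDigitsʳ (b ∷ v)
  ∎
  where
  open ≡-Reasoning
  ru = fromDigitsʳ u
  rv = fromDigitsʳ v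
  S = 10 ^ (length v ∸ length u)
  split : 10 ^ length u * S ≡ 10 ^ length v
  split = trans (sym (^-distribˡ-+-* 10 (length u) _)) (cong (10 ^_) (m+[n∸m]≡n u≤v))
  regroup : ∀ ru rv a b p s → ru * s + rv + (a + b) * (p * s) ≡ (ru + a * p) * s + (rv + b * (p * s))
  regroup = solve-∀

-- In (a ∷ p) ⊗ q = a·q ⊕ (0 ∷ p ⊗ q) the scaled copy a·q is the shorter summand.
scaled-fits : ∀ a p₀ p q → length ((p₀ ∷ p) ⊗ q) ≡ length p + length q →
              length (map (a *_) q) ≤ length (0 ∷ ((p₀ ∷ p) ⊗ q))
scaled-fits a p₀ p q |pq| rewrite length-map (a *_) q | |pq| = ≤-trans (m≤n+m _ (length p)) (n≤1+n _)

length-⊗ : ∀ p q → 1 ≤ length p → 1 ≤ length q → length (p ⊗ q) ≡ length p + length q ∸ 1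
length-⊗ (a ∷ [])     (b ∷ q) _ _ =
  cong suc (trans (cong length (⊕-identityʳ (map (a *_) q))) (length-map (a *_) q))
length-⊗ (a ∷ p₀ ∷ p) q       _   1≤q with length-⊗ (p₀ ∷ p) q (s≤s z≤n) 1≤q
... | |pq| = trans (length-⊕ (map (a *_) q) (0 ∷ ((p₀ ∷ p) ⊗ q)) (scaled-fits a p₀ p q |pq|)) (cong suc |pq|)

-- The reversed reading is multiplicative as well: reversing the coefficients
-- of a product of polynomials reverses those of each factor.
fromDigitsʳ-⊗ : ∀ p q → 1 ≤ length p → 1 ≤ length q →
                fromDigitsʳ (p ⊗ q) ≡ fromDigitsʳ p * fromDigitsʳ q
fromDigitsʳ-⊗ (a ∷ []) (b ∷ q) _ _ rewrite ⊕-identityʳ (map (a *_) q) = begin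
    fromDigitsʳ ((a * b + 0) ∷ map (a *_) q)
  ≡⟨ fromDigitsʳ-∷ (a * b + 0) (map (a *_) q) ⟩
    fromDigitsʳ (map (a *_) q) + (a * b + 0) * 10 ^ length (map (a *_) q)
  ≡⟨ cong₂ (λ x k → x + (a * b + 0) * 10 ^ k) (fromDigitsʳ-scale a q) (length-map (a *_) q) ⟩
    a * fromDigitsʳ q + (a * b + 0) * 10 ^ length q
  ≡⟨ distribute a b (fromDigitsʳ q) (10 ^ length q) ⟩
    (a + 10 * 0) * (fromDigitsʳ q + b * 10 ^ length q)
  ≡⟨ cong ((a + 10 * 0) *_) (sym (fromDigitsʳ-∷ b q)) ⟩
    fromDigitsʳ (a ∷ []) * fromDigitsʳ (b ∷ q)
  ∎
  where
  open ≡-Reasoning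
  distribute : ∀ a b r P → a * r + (a * b + 0) * P ≡ (a + 10 * 0) * (r + b * P)
  distribute = solve-∀
fromDigitsʳ-⊗ (a ∷ p₀ ∷ p) q _ 1≤q = begin
    fromDigitsʳ (map (a *_) q ⊕ (0 ∷ r))
  ≡⟨ fromDigitsʳ-⊕ (map (a *_) q) (0 ∷ r) (scaled-fits a p₀ p q |r|) ⟩
    fromDigitsʳ (map (a *_) q) * 10 ^ (length (0 ∷ r) ∸ length (map (a *_) q)) + fromDigitsʳ (0 ∷ r)
  ≡⟨ cong₂ (λ x k → x * 10 ^ k + fromDigitsʳ (0 ∷ r)) (fromDigitsʳ-scale a q) gap ⟩
    a * rq * P + fromDigitsʳ (0 ∷ r)
  ≡⟨ cong (a * rq * P +_) (trans (fromDigitsʳ-∷ 0 r) (+-identityʳ _)) ⟩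
    a * rq * P + fromDigitsʳ r
  ≡⟨ cong (a * rq * P +_) (fromDigitsʳ-⊗ (p₀ ∷ p) q (s≤s z≤n) 1≤q) ⟩
    a * rq * P + fromDigitsʳ (p₀ ∷ p) * rq
  ≡⟨ factor a rq P (fromDigitsʳ (p₀ ∷ p)) ⟩
    (fromDigitsʳ (p₀ ∷ p) + a * P) * rq
  ≡⟨ cong (_* rq) (sym (fromDigitsʳ-∷ a (p₀ ∷ p))) ⟩
    fromDigitsʳ (a ∷ p₀ ∷ p) * rq
  ∎
  where
  open ≡-Reasoning
  r = (p₀ ∷ p) ⊗ q
  rq = fromDigitsʳ q
  P = 10 ^ length (p₀ ∷ p)
  |r| : length r ≡ length p + length q
  |r| = length-⊗ (p₀ ∷ p) q (s≤s z≤n) 1≤q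
  gap : length (0 ∷ r) ∸ length (map (a *_) q) ≡ length (p₀ ∷ p)
  gap rewrite |r| | length-map (a *_) q = m+n∸n≡m (length (p₀ ∷ p)) (length q)
  factor : ∀ a r P s → a * r * P + s * r ≡ (s + a * P) * r
  factor = solve-∀

-- If the lowest coefficient x of a list and the lowest digit y of a digit list
-- give the same value, then x ≡ y (mod 10), so y ≤ x.
lowest-digit-≤ : ∀ {x y} u v → y < 10 → x + 10 * u ≡ y + 10 * v → y ≤ x
lowest-digit-≤ {x} {y} u v y<10 same = subst (_≤ x) x%10≡y (m%n≤m x 10)
  where
  x%10≡y : x % 10 ≡ y
  x%10≡y = trans (sym (%10-shift x u)) (trans (cong (_% 10) same) (%10-∷ v y<10))

leading-≤ : ∀ {r s x y} P → r + x * P ≤ s + y * P → s < P → x ≤ y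
leading-≤ {r} {s} {x} {y} P below s<P = ≤-pred (*-cancelʳ-< P x (suc y) (begin-strict
    x * P        ≤⟨ m≤n+m (x * P) r ⟩
    r + x * P    ≤⟨ below ⟩
    s + y * P    <⟨ +-monoˡ-< (y * P) s<P ⟩
    P + y * P    ∎))
  where open ≤-Reasoning

digit-list-unique : ∀ c d → length c ≡ length d → All (_< 10) d →
                    fromDigits c ≡ fromDigits d → fromDigitsʳ c ≤ fromDigitsʳ d → c ≡ d
digit-list-unique []      []      _     _             _    _    = refl
digit-list-unique (x ∷ c) (y ∷ d) |c|≡|d| (y<10 ∷ d<10) same below =
  cong₂ _∷_ x≡y (digit-list-unique c d (suc-injective |c|≡|d|) d<10 same-tail below-tail)
  where
  P = 10 ^ length c
  below′ : fromDigitsʳ c + x * P ≤ fromDigitsʳ d + y * P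
  below′ = subst₂ _≤_ (fromDigitsʳ-∷ x c)
                      (trans (fromDigitsʳ-∷ y d) (cong (λ k → fromDigitsʳ d + y * 10 ^ k) (sym (suc-injective |c|≡|d|))))
                      below
  d<P : fromDigitsʳ d < P
  d<P = subst (λ k → fromDigitsʳ d < 10 ^ k) (sym (suc-injective |c|≡|d|)) (fromDigitsʳ-< d d<10)
  x≡y : x ≡ y
  x≡y = ≤-antisym (leading-≤ P below′ d<P) (lowest-digit-≤ (fromDigits c) (fromDigits d) y<10 same)
  same-tail : fromDigits c ≡ fromDigits d
  same-tail = *-cancelˡ-≡ _ _ 10 (+-cancelˡ-≡ y _ _ (subst (λ z → z + 10 * fromDigits c ≡ _) x≡y same))
  below-tail : fromDigitsʳ c ≤ fromDigitsʳ d
  below-tail = +-cancelʳ-≤ (y * P) _ _ (subst (λ z → fromDigitsʳ c + z * P ≤ fromDigitsʳ d + y * P) x≡y below′)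

-- The lowest digit of the reversal of a canonical nonempty list is its
-- (nonzero) leading digit, so the reversal is not divisible by 10.
fromDigitsʳ-%10≢0 : ∀ x l → Canonical (x ∷ l) → fromDigitsʳ (x ∷ l) % 10 ≢ 0
fromDigitsʳ-%10≢0 x []      (cons x<10 _ positive) ends0 =
  <-irrefl refl (subst (λ z → 0 < z + 10 * 0) (trans (sym (%10-∷ 0 x<10)) ends0) positive)
fromDigitsʳ-%10≢0 x (y ∷ l) (cons _ c _)          ends0 =
  fromDigitsʳ-%10≢0 y l c (begin
    fromDigitsʳ (y ∷ l) % 10                              ≡⟨ sym (%10-shift (fromDigitsʳ (y ∷ l)) (x * 10 ^ length l)) ⟩
    (fromDigitsʳ (y ∷ l) + 10 * (x * 10 ^ length l)) % 10  ≡⟨ cong (λ z → (fromDigitsʳ (y ∷ l) + z) % 10) (shift x _) ⟩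
    (fromDigitsʳ (y ∷ l) + x * 10 ^ length (y ∷ l)) % 10   ≡⟨ cong (_% 10) (sym (fromDigitsʳ-∷ x (y ∷ l))) ⟩
    fromDigitsʳ (x ∷ y ∷ l) % 10                          ≡⟨ ends0 ⟩
    0                                                     ∎)
  where
  open ≡-Reasoning
  shift : ∀ x p → 10 * (x * p) ≡ x * (10 * p)
  shift = solve-∀

rev-%10≢0 : ∀ m → 0 < numDigits m → rev m % 10 ≢ 0
rev-%10≢0 m positive with digits m | canonical-digits m
rev-%10≢0 m ()       | []    | _
rev-%10≢0 m _        | x ∷ l | c = fromDigitsʳ-%10≢0 x l c

factor-%10≢0 : ∀ a b → (a * b) % 10 ≢ 0 → a % 10 ≢ 0
factor-%10≢0 a b ab≢0 a≡0 = ab≢0 (trans (%-distribˡ-* a b 10) (cong (λ z → (z * (b % 10)) % 10) a≡0))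

-- If A · A* is a positive palindrome then A does not end in 0: otherwise the
-- product ends in 0, while as a reversal it cannot.
palindromic-product-%10≢0 : ∀ A → Palindrome (A * rev A) → 0 < numDigits (A * rev A) → A % 10 ≢ 0
palindromic-product-%10≢0 A palindrome positive =
  factor-%10≢0 A (rev A) (subst (λ m → m % 10 ≢ 0) (sym palindrome) (rev-%10≢0 (A * rev A) positive))

0<2n∸1 : ∀ {n} → 1 ≤ n → 0 < 2 * n ∸ 1
0<2n∸1 {suc n} _ = ≤-trans (s≤s z≤n) (m≤n+m (suc (n + 0)) n)

proposition14 : (n A : ℕ) → n ≥ 1 → A > 0 → numDigits A ≡ n
    → Palindrome (A * rev A) → numDigits (A * rev A) ≡ 2 * n ∸ 1
    → PolynomialPair A (rev A)
proposition14 n A n≥1 _ |A|≡n palindrome |N|≡2n-1 = begin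
    a ⊗ digits (rev A)   ≡⟨ cong (a ⊗_) (digits-rev A (palindromic-product-%10≢0 A palindrome 0<|N|)) ⟩
    a ⊗ reverse a        ≡⟨ digit-list-unique (a ⊗ reverse a) (digits N) same-length
                              (canonical⇒digits (canonical-digits N)) same-value same-reversal ⟩
    digits N             ∎
  where
  open ≡-Reasoning
  N = A * rev A
  a = digits A
  1≤|a| : 1 ≤ length a
  1≤|a| = subst (1 ≤_) (sym |A|≡n) n≥1
  1≤|a*| : 1 ≤ length (reverse a)
  1≤|a*| = subst (1 ≤_) (sym (length-reverse a)) 1≤|a|
  0<|N| : 0 < numDigits N
  0<|N| = subst (0 <_) (sym |N|≡2n-1) (0<2n∸1 n≥1)
  same-length : length (a ⊗ reverse a) ≡ length (digits N)
  same-length = begin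
    length (a ⊗ reverse a)         ≡⟨ length-⊗ a (reverse a) 1≤|a| 1≤|a*| ⟩
    length a + length (reverse a) ∸ 1 ≡⟨ cong (λ k → length a + k ∸ 1) (length-reverse a) ⟩
    length a + length a ∸ 1        ≡⟨ cong (λ k → k + k ∸ 1) |A|≡n ⟩
    n + n ∸ 1                      ≡⟨ cong (λ k → n + k ∸ 1) (sym (+-identityʳ n)) ⟩
    2 * n ∸ 1                      ≡⟨ sym |N|≡2n-1 ⟩
    length (digits N)              ∎
  same-value : fromDigits (a ⊗ reverse a) ≡ fromDigits (digits N)
  same-value = begin
    fromDigits (a ⊗ reverse a)     ≡⟨ fromDigits-⊗ a (reverse a) ⟩
    fromDigits a * rev A           ≡⟨ cong (_* rev A) (fromDigits-digits A) ⟩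
    N                              ≡⟨ sym (fromDigits-digits N) ⟩
    fromDigits (digits N)          ∎
  same-reversal : fromDigitsʳ (a ⊗ reverse a) ≤ fromDigitsʳ (digits N)
  same-reversal = ≤-reflexive (begin
    fromDigitsʳ (a ⊗ reverse a)    ≡⟨ fromDigitsʳ-⊗ a (reverse a) 1≤|a| 1≤|a*| ⟩
    rev A * fromDigitsʳ (reverse a) ≡⟨ cong (λ l → rev A * fromDigits l) (reverse-involutive a) ⟩
    rev A * fromDigits a           ≡⟨ cong (rev A *_) (fromDigits-digits A) ⟩
    rev A * A                      ≡⟨ *-comm (rev A) A ⟩
    N                              ≡⟨ palindrome ⟩
    rev N                          ∎)
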